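{- If $t$ is a closed normal term of star type $\rho^*$ in the star combinatory calculus for arithmetic, then $t$ is set-like and $\mathrm{SM}(t)$ is a finite non-empty set of closed normal terms of type $\rho$.
   Context: Star combinatory calculus for arithmetic: types are generated from the ground type $N$ by $\sigma\to\tau$ and $\sigma^*$. Constants: $0:N$, $S:N\to N$, $R_\sigma:N\to\sigma\to(\sigma\to N\to\sigma)\to\sigma$; $\Pi_{\sigma,\tau}:\sigma\to\tau\to\sigma$; $\Sigma_{\rho,\sigma,\tau}:(\rho\to\sigma\to\tau)\to(\rho\to\sigma)\to\rho\to\tau$; $\mathfrak{s}_\sigma:\sigma\to\sigma^*$; $\cup_\sigma:\sigma^*\to\sigma^*\to\sigma^*$; $\bigcup_{\sigma,\tau}:\sigma^*\to(\sigma\to\tau^*)\to\tau^*$. Terms: constants, typed variables, applications; closed means containing no variables. Conversions: $\Sigma tqr\rightsquigarrow tr(qr)$; $\Pi tq\rightsquigarrow t$; $\bigcup(\mathfrak{s}t)q\rightsquigarrow qt$; $\bigcup(\cup tq)r\rightsquigarrow\cup(\bigcup tr)(\bigcup qr)$; $R0qr\rightsquigarrow q$; $R(St)qr\rightsquigarrow r(Rtqr)t$. A term is normal if no conversion applies to any of its subterms. A term of star type is set-like if it is built from terms of the form $\mathfrak{s}q$ using only the constant $\cup$ (i.e. it is $\mathfrak{s}q$ or $\cup t_1t_2$ with $t_1,t_2$ set-like). For $t$ of type $\sigma^*$, the surface elements $\mathrm{SM}(t)$ are: $\{q\}$ if $t=\mathfrak{s}q$; $\mathrm{SM}(q)\cup\mathrm{SM}(r)$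 if $t=\cup qr$; $\emptyset$ otherwise. -}

module Defs where

open import Data.Nat using (ℕ)
open import Data.List using (List; []; _∷_; _++_)
open import Data.Product using (_×_)
open import Relation.Nullary using (¬_)

infixr 30 _⇒_
infix 40 _*

data Ty : Set where
  N   : Ty
  _⇒_ : Ty → Ty → Ty
  _*  : Ty → Ty

data Tm : Ty → Set where
  var  : (σ : Ty) → ℕ → Tm σ
  𝟘    : Tm N
  S    : Tm (N ⇒ N)
  R    : (σ : Ty) → Tm (N ⇒ σ ⇒ (σ ⇒ N ⇒ σ) ⇒ σ)
  Π    : (σ τ : Ty) → Tm (σ ⇒ τ ⇒ σ)
  Σ    : (ρ σ τ : Ty) → Tm ((ρ ⇒ σ ⇒ τ) ⇒ (ρ ⇒ σ) ⇒ ρ ⇒ τ)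
  sng  : (σ : Ty) → Tm (σ ⇒ σ *)
  cup  : (σ : Ty) → Tm (σ * ⇒ σ * ⇒ σ *)
  Cup  : (σ τ : Ty) → Tm (σ * ⇒ (σ ⇒ τ *) ⇒ τ *)
  app  : ∀ {σ τ} → Tm (σ ⇒ τ) → Tm σ → Tm τ

data Closed : ∀ {σ} → Tm σ → Set where
  c-𝟘   : Closed 𝟘
  c-S   : Closed S
  c-R   : ∀ σ → Closed (R σ)
  c-Π   : ∀ σ τ → Closed (Π σ τ)
  c-Σ   : ∀ ρ σ τ → Closed (Σ ρ σ τ)
  c-sng : ∀ σ → Closed (sng σ)
  c-cup : ∀ σ → Closed (cup σ)
  c-Cup : ∀ σ τ → Closed (Cup σ τ)
  c-app : ∀ {σ τ} {t : Tm (σ ⇒ τ)} {q : Tm σ} → Closed t → Closed q → Closed (app t q)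

data Redex : ∀ {τ} → Tm τ → Set where
  Σ-red  : ∀ {ρ σ τ} (t : Tm (ρ ⇒ σ ⇒ τ)) (q : Tm (ρ ⇒ σ)) (r : Tm ρ) →
           Redex (app (app (app (Σ ρ σ τ) t) q) r)
  Π-red  : ∀ {σ τ} (t : Tm σ) (q : Tm τ) → Redex (app (app (Π σ τ) t) q)
  Us-red : ∀ {σ τ} (t : Tm σ) (q : Tm (σ ⇒ τ *)) →
           Redex (app (app (Cup σ τ) (app (sng σ) t)) q)
  U∪-red : ∀ {σ τ} (t q : Tm (σ *)) (r : Tm (σ ⇒ τ *)) →
           Redex (app (app (Cup σ τ) (app (app (cup σ) t) q)) r)
  R0-red : ∀ {σ} (q : Tm σ) (r : Tm (σ ⇒ N ⇒ σ)) →
           Redex (app (app (app (R σ) 𝟘) q) r)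
  RS-red : ∀ {σ} (t : Tm N) (q : Tm σ) (r : Tm (σ ⇒ N ⇒ σ)) →
           Redex (app (app (app (R σ) (app S t)) q) r)

Normal : ∀ {σ} → Tm σ → Set
Normal (app t q) = ¬ Redex (app t q) × Normal t × Normal q
Normal t         = ¬ Redex t

data SetLike : ∀ {σ} → Tm (σ *) → Set where
  sl-sng : ∀ {σ} (q : Tm σ) → SetLike (app (sng σ) q)
  sl-cup : ∀ {σ} {t₁ t₂ : Tm (σ *)} → SetLike t₁ → SetLike t₂ →
           SetLike (app (app (cup σ) t₁) t₂)

-- Surface elements, as a (finite) list; the set SM(t) is its set of members.
SM : ∀ {σ} → Tm (σ *) → List (Tm σ)
SM (app (sng _) q)          = q ∷ []
SM (app (app (cup _) q) r)  = SM q ++ SM r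
SM _                        = []

-- A closed normal term is a constant applied to fewer arguments than its
-- arity: applying one more argument either stays below the arity or, at full
-- arity, creates a redex.  For R and ⋃ the redex is created only because the
-- inspected argument (the numeral of R, the set of ⋃) is itself closed and
-- normal, hence of the form 0, S m, 𝔰 q or ∪ a b.  At star type the only
-- constants below their arity are 𝔰 q and ∪ a b, so a closed normal term of
-- star type is set-like by induction.  The surface elements of a set-like
-- term are among its subterms, hence closed and normal, and there is at
-- least one.
module Submission where

open import Defs
open import Data.List using ([]; _++_)
open import Data.List.Properties using (++-conicalˡ)
open import Data.List.Relation.Unary.All using (All; []; _∷_; zip)
open import Data.List.Relation.Unary.All.Properties using (++⁺)
open import Data.Product using (_×_; _,_)
open import Relation.Nullary using (¬_; contradiction)
open import Relation.Binary.PropositionalEquality using (_≢_)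

data Canonical : ∀ {σ} → Tm σ → Set where
  𝟘₀   : Canonical 𝟘
  S₀   : Canonical S
  S₁   : ∀ {n} → Canonical (app S n)
  R₀   : ∀ {σ} → Canonical (R σ)
  R₁   : ∀ {σ n} → Canonical n → Canonical (app (R σ) n)
  R₂   : ∀ {σ n q} → Canonical n → Canonical (app (app (R σ) n) q)
  Π₀   : ∀ {σ τ} → Canonical (Π σ τ)
  Π₁   : ∀ {σ τ t} → Canonical (app (Π σ τ) t)
  Σ₀   : ∀ {ρ σ τ} → Canonical (Σ ρ σ τ)
  Σ₁   : ∀ {ρ σ τ t} → Canonical (app (Σ ρ σ τ) t)
  Σ₂   : ∀ {ρ σ τ t q} → Canonical (app (app (Σ ρ σ τ) t) q)
  sng₀ : ∀ {σ} → Canonical (sng σ)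
  sng₁ : ∀ {σ q} → Canonical (app (sng σ) q)
  cup₀ : ∀ {σ} → Canonical (cup σ)
  cup₁ : ∀ {σ a} → Canonical (app (cup σ) a)
  cup₂ : ∀ {σ a b} → Canonical (app (app (cup σ) a) b)
  Cup₀ : ∀ {σ τ} → Canonical (Cup σ τ)
  Cup₁ : ∀ {σ τ a} → Canonical a → Canonical (app (Cup σ τ) a)

canonical-app : ∀ {σ τ} {f : Tm (σ ⇒ τ)} {x : Tm σ} →
                Canonical f → Canonical x → ¬ Redex (app f x) → Canonical (app f x)
canonical-app S₀          _  _  = S₁
canonical-app R₀          cx _  = R₁ cx
canonical-app (R₁ cn)     _  _  = R₂ cn
canonical-app (R₂ 𝟘₀)     _  nr = contradiction (R0-red _ _) nr
canonical-app (R₂ S₁)     _  nr = contradiction (RS-red _ _ _) nr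
canonical-app Π₀          _  _  = Π₁
canonical-app Π₁          _  nr = contradiction (Π-red _ _) nr
canonical-app Σ₀          _  _  = Σ₁
canonical-app Σ₁          _  _  = Σ₂
canonical-app Σ₂          _  nr = contradiction (Σ-red _ _ _) nr
canonical-app sng₀        _  _  = sng₁
canonical-app cup₀        _  _  = cup₁
canonical-app cup₁        _  _  = cup₂
canonical-app Cup₀        cx _  = Cup₁ cx
canonical-app (Cup₁ sng₁) _  nr = contradiction (Us-red _ _) nr
canonical-app (Cup₁ cup₂) _  nr = contradiction (U∪-red _ _ _) nr

closed-normal⇒canonical : ∀ {σ} {t : Tm σ} → Closed t → Normal t → Canonical t
closed-normal⇒canonical c-𝟘         _ = 𝟘₀
closed-normal⇒canonical c-S         _ = S₀
closed-normal⇒canonical (c-R _)     _ = R₀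
closed-normal⇒canonical (c-Π _ _)   _ = Π₀
closed-normal⇒canonical (c-Σ _ _ _) _ = Σ₀
closed-normal⇒canonical (c-sng _)   _ = sng₀
closed-normal⇒canonical (c-cup _)   _ = cup₀
closed-normal⇒canonical (c-Cup _ _) _ = Cup₀
closed-normal⇒canonical (c-app cf cx) (nr , nf , nx) =
  canonical-app (closed-normal⇒canonical cf nf) (closed-normal⇒canonical cx nx) nr

closed-normal⇒setLike : ∀ {σ} {t : Tm (σ *)} → Closed t → Normal t → SetLike t
closed-normal⇒setLike ct nt with closed-normal⇒canonical ct nt
closed-normal⇒setLike _ _ | sng₁ = sl-sng _
closed-normal⇒setLike (c-app (c-app _ ca) cb) (_ , (_ , _ , na) , nb) | cup₂ =
  sl-cup (closed-normal⇒setLike ca na) (closed-normal⇒setLike cb nb)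

SM-nonempty : ∀ {σ} {t : Tm (σ *)} → SetLike t → SM t ≢ []
SM-nonempty (sl-sng _) ()
SM-nonempty (sl-cup {t₁ = a} {t₂ = b} sa _) e = SM-nonempty sa (++-conicalˡ (SM a) (SM b) e)

SM-closed : ∀ {σ} {t : Tm (σ *)} → SetLike t → Closed t → All Closed (SM t)
SM-closed (sl-sng _)     (c-app _ cq)            = cq ∷ []
SM-closed (sl-cup sa sb) (c-app (c-app _ ca) cb) = ++⁺ (SM-closed sa ca) (SM-closed sb cb)

SM-normal : ∀ {σ} {t : Tm (σ *)} → SetLike t → Normal t → All Normal (SM t)
SM-normal (sl-sng _)     (_ , _ , nq)            = nq ∷ []
SM-normal (sl-cup sa sb) (_ , (_ , _ , na) , nb) = ++⁺ (SM-normal sa na) (SM-normal sb nb)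

theorem11 : ∀ {ρ} (t : Tm (ρ *)) → Closed t → Normal t →
    SetLike t × SM t ≢ [] × All (λ q → Closed q × Normal q) (SM t)
theorem11 t ct nt = sl , SM-nonempty sl , zip (SM-closed sl ct , SM-normal sl nt)
  where
  sl : SetLike t
  sl = closed-normal⇒setLike ct nt
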